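{- For any $m\in\mathbb N$ and $j<m$, there are first-order sentences $\varphi$ and $\psi$ in the language of dynamical systems such that for every sequence $\bar n=(n_k)_{k\in\omega}$ of natural numbers: (i) $\mathfrak A_{\bar n}\models\varphi$ if and only if $n_k\equiv j\pmod m$ for all but finitely many $k\in\omega$; (ii) $\mathfrak A_{\bar n}\models\psi$ if and only if $n_k\equiv j\pmod m$ for infinitely many $k\in\omega$.
   Context: The language of dynamical systems is the language of Boolean algebras expanded by one unary function symbol. For a sequence $\bar n=(n_k)$, let $I_k=[\sum_{i<k}n_i,\sum_{i\le k}n_i)$ be consecutive intervals of $\mathbb N$; the rotary permutation $r_{\bar n}$ cyclically permutes each $I_k$ ($i\mapsto i+1$ except $\max I_k\mapsto\min I_k$). $\alpha_{\bar n}([A]_{\mathrm{Fin}})=[r_{\bar n}[A]]_{\mathrm{Fin}}$ is an automorphism of $\mathcal P(\mathbb N)/\mathrm{Fin}$, and $\mathfrak A_{\bar n}=\langle\mathcal P(\mathbb N)/\mathrm{Fin},\alpha_{\bar n}\rangle$ with the function symbol interpreted as $\alpha_{\bar n}$. -}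

module Defs where

open import Level using (Level; 0ℓ)
open import Data.Bool using (Bool; true; false; if_then_else_; _∧_; _∨_; not)
open import Data.Nat using (ℕ; zero; suc; _+_; _∸_; _≤_; _<_; _<ᵇ_; _≡ᵇ_)
open import Data.Fin using (Fin)
import Data.Fin as Fin
open import Data.Integer using (ℤ; +_; _-_)
open import Data.Integer.Divisibility using (_∣_)
open import Data.Product using (Σ; _×_)
open import Data.Empty using (⊥)
open import Data.Unit using (⊤)
open import Relation.Nullary using (¬_)
open import Relation.Binary.PropositionalEquality using (_≡_)

-- Syntax: first-order language of dynamical systems
-- (Boolean algebras: ⊔, ⊓, complement, 0, 1; plus one unary function symbol f).

data Term (n : ℕ) : Set where
  var  : Fin n → Term n
  𝟘 𝟙  : Term n
  _⊔_ _⊓_ : Term n → Term n → Term n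
  ∁_   : Term n → Term n
  f    : Term n → Term n

data Formula (n : ℕ) : Set where
  _≐_   : Term n → Term n → Formula n
  ⊥f ⊤f : Formula n
  ¬f_   : Formula n → Formula n
  _∧f_ _∨f_ _⇒f_ : Formula n → Formula n → Formula n
  ∀f ∃f : Formula (suc n) → Formula n

Sentence : Set
Sentence = Formula 0

-- The structure 𝔄_n̄ = ⟨P(ℕ)/Fin, α_n̄⟩.
-- A subset of ℕ is a characteristic function ℕ → Bool; an element of
-- P(ℕ)/Fin is represented by a subset, equality being =* (mod Fin).

Subset : Set
Subset = ℕ → Bool

_=*_ : Subset → Subset → Set
A =* B = Σ ℕ λ N → ∀ i → N ≤ i → A i ≡ B i

-- start of interval I_k :  S k = Σ_{i<k} n_i ,  I_k = [S k , S (k+1))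
S : (ℕ → ℕ) → ℕ → ℕ
S n zero    = 0
S n (suc k) = S n k + n k

-- index k of the interval I_k containing x (search with fuel; correct
-- whenever all n_k ≥ 1, since then x < S (x+1))
blockFrom : (ℕ → ℕ) → ℕ → ℕ → ℕ → ℕ
blockFrom n zero       k x = k
blockFrom n (suc fuel) k x = if x <ᵇ S n (suc k) then k else blockFrom n fuel (suc k) x

block : (ℕ → ℕ) → ℕ → ℕ
block n x = blockFrom n (suc x) 0 x

rot : (ℕ → ℕ) → ℕ → ℕ
rot n x = if suc x ≡ᵇ S n (suc (block n x)) then S n (block n x) else suc x

rotInv : (ℕ → ℕ) → ℕ → ℕ
rotInv n x = if x ≡ᵇ S n (block n x) then S n (suc (block n x)) ∸ 1 else x ∸ 1

-- image r_n̄[A] : y ∈ r[A] ⟺ r⁻¹(y) ∈ A  (r is a bijection of ℕ)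
image : (ℕ → ℕ) → Subset → Subset
image n A y = A (rotInv n y)

α : (ℕ → ℕ) → Subset → Subset
α n A = image n A

-- Semantics (classical, via the Gödel–Gentzen negative translation:
-- ∨ and ∃ are read classically as ¬(¬∧¬) and ¬∀¬, atoms are ¬¬-stable).

Env : ℕ → Set
Env k = Fin k → Subset

extend : ∀ {k} → Subset → Env k → Env (suc k)
extend a ρ Fin.zero    = a
extend a ρ (Fin.suc i) = ρ i

evalT : (ℕ → ℕ) → ∀ {k} → Env k → Term k → Subset
evalT n ρ (var i)  = ρ i
evalT n ρ 𝟘        = λ _ → false
evalT n ρ 𝟙        = λ _ → true
evalT n ρ (s ⊔ t)  = λ i → evalT n ρ s i ∨ evalT n ρ t i
evalT n ρ (s ⊓ t)  = λ i → evalT n ρ s i ∧ evalT n ρ t i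
evalT n ρ (∁ t)    = λ i → not (evalT n ρ t i)
evalT n ρ (f t)    = α n (evalT n ρ t)

Sat : (ℕ → ℕ) → ∀ {k} → Env k → Formula k → Set
Sat n ρ (s ≐ t)  = ¬ ¬ (evalT n ρ s =* evalT n ρ t)
Sat n ρ ⊥f       = ⊥
Sat n ρ ⊤f       = ⊤
Sat n ρ (¬f φ)   = ¬ Sat n ρ φ
Sat n ρ (φ ∧f ψ) = Sat n ρ φ × Sat n ρ ψ
Sat n ρ (φ ∨f ψ) = ¬ (¬ Sat n ρ φ × ¬ Sat n ρ ψ)
Sat n ρ (φ ⇒f ψ) = Sat n ρ φ → Sat n ρ ψ
Sat n ρ (∀f φ)   = (a : Subset) → Sat n (extend a ρ) φ
Sat n ρ (∃f φ)   = ¬ ((a : Subset) → ¬ Sat n (extend a ρ) φ)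

noVars : Env 0
noVars ()

_⊨_ : (ℕ → ℕ) → Sentence → Set
n ⊨ φ = Sat n noVars φ

_≡_[mod_] : ℕ → ℕ → ℕ → Set
a ≡ b [mod m ] = (+ m) ∣ (+ a - + b)

AlmostAll : (ℕ → Set) → Set
AlmostAll P = ¬ ¬ (Σ ℕ λ K → ∀ k → K ≤ k → P k)

InfinitelyMany : (ℕ → Set) → Set
InfinitelyMany P = ∀ K → ¬ ¬ (Σ ℕ λ k → K ≤ k × P k)

-- Take φ = ∃ Y. Y = 1 ∧ Φ(Y) and ψ = ∃ Y. Y ≠ 0 ∧ Φ(Y), where Φ(Y) says that Y is invariant and that
-- there are a marker E and colours A₀ … A_{m-1} such that, modulo finite sets,
--   * every subset of E is the trace on E of an invariant set; as invariant sets are, up to a finite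
--     set, unions of blocks I_k, E has at most one point in almost every block;
--   * every invariant subset of Y disjoint from E is finite, so E meets almost every block inside Y;
--   * E ⊆ A₀, the rotation carries A_c outside E into A_{c+1}, and it may carry A_c into E only if
--     c + 1 ≡ j (mod m).
-- Walking once around a block of Y from its mark, the t-th point has colour t mod m, and the step back
-- onto the mark forces n_k ≡ j.  Conversely, marking the first point of every block with n_k ≡ j and
-- colouring each point by its offset in its block satisfies Φ.  Sat reads atoms and ∃ classically, so
-- the arguments run in the double-negation monad.
module Submission where

open import Defs
open import Level using (0ℓ)
open import Data.Bool using (Bool; true; false; _∧_; _∨_; not; if_then_else_; T)
open import Data.Bool.Properties using (∨-zeroʳ; ∧-conicalˡ; ∧-conicalʳ; ∧-zeroʳ; ∧-identityʳ; ¬-not)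
open import Data.Nat
  using (ℕ; zero; suc; _+_; _*_; _∸_; _≤_; _<_; _%_; _/_; NonZero; >-nonZero; z≤n; s≤s; s≤s⁻¹; z<s; _<ᵇ_; _≡ᵇ_)
  renaming (_⊔_ to _⊔ℕ_)
open import Data.Nat.Properties
open import Data.Nat.DivMod
  using (_mod_; m≡m%n+[m/n]*n; m%n<n; m%n%n≡m%n; [m+n]%n≡m%n; m<n⇒m%n≡m; n%n≡0; %-distribˡ-+; %-remove-+ʳ)
open import Data.Nat.Divisibility using (divides; >⇒∤) renaming (_∣_ to _∣ℕ_)
import Data.Integer as ℤ
open ℤ using (∣_∣)
open import Data.Integer.Properties using (m-n≡m⊖n; ⊖-≥; ∣⊖∣-≤)
open import Data.Fin using (Fin; toℕ; zero; suc; _↑ˡ_; _↑ʳ_) renaming (_≟_ to _≟ᶠ_)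
open import Data.Fin.Properties using (toℕ-injective; toℕ-fromℕ<; sequence)
open import Data.Vec.Functional using (_∷_)
open import Data.Empty using (⊥; ⊥-elim)
open import Data.Product using (Σ; _×_; _,_; proj₁; proj₂; map₂)
open import Data.Sum using (inj₁; inj₂)
open import Function using (_∘_; case_of_)
open import Function.Bundles using (_⇔_; mk⇔; Equivalence)
open import Function.Properties.Equivalence using () renaming (trans to ⇔-trans; sym to ⇔-sym)
open import Relation.Nullary using (¬_; Dec; does; yes; no)
open import Relation.Nullary.Decidable using (dec-true)
open import Relation.Nullary.Negation using (contradiction; ¬¬-Monad; ¬¬-map; ¬∃⟶∀¬; ∀¬⟶¬∃)
open import Effect.Monad using (RawMonad)
open import Relation.Binary.PropositionalEquality
open import Relation.Binary.Definitions using (tri<; tri≈; tri>)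

open Equivalence using (to; from)
open RawMonad (¬¬-Monad {0ℓ}) using (pure; _>>=_) renaming (rawApplicative to ¬¬-applicative)

Eventually : (ℕ → Set) → Set
Eventually P = Σ ℕ λ N → ∀ x → N ≤ x → P x

always : {P : ℕ → Set} → (∀ x → P x) → Eventually P
always h = 0 , λ x _ → h x

module _ {P Q : ℕ → Set} where

  eventually-map : (∀ {x} → P x → Q x) → Eventually P → Eventually Q
  eventually-map g (N , h) = N , λ x N≤x → g (h x N≤x)

  eventually-zip : Eventually P → Eventually Q → Eventually (λ x → P x × Q x)
  eventually-zip (M , hP) (N , hQ) =
    M ⊔ℕ N , λ x M⊔N≤x → hP x (m⊔n≤o⇒m≤o M N M⊔N≤x) , hQ x (m⊔n≤o⇒n≤o M N M⊔N≤x)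

eventually-∀ : ∀ {m} {P : Fin m → ℕ → Set} →
               (∀ i → Eventually (P i)) → Eventually (λ x → ∀ i → P i x)
eventually-∀ {zero}      h = 0 , λ _ _ ()
eventually-∀ {suc m} {P} h = eventually-map cons (eventually-zip (h zero) (eventually-∀ (h ∘ suc)))
  where
  cons : ∀ {x} → P zero x × (∀ i → P (suc i) x) → ∀ i → P i x
  cons (p , ps) zero    = p
  cons (p , ps) (suc i) = ps i

module _ {P Q : ℕ → Set} (P⇔Q : ∀ k → P k ⇔ Q k) where

  AlmostAll-cong : AlmostAll P ⇔ AlmostAll Q
  AlmostAll-cong = mk⇔ (¬¬-map (eventually-map (to (P⇔Q _)))) (¬¬-map (eventually-map (from (P⇔Q _))))

  InfinitelyMany-cong : InfinitelyMany P ⇔ InfinitelyMany Q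
  InfinitelyMany-cong = mk⇔ (λ many K → ¬¬-map (map₂ (map₂ (to (P⇔Q _)))) (many K))
                            (λ many K → ¬¬-map (map₂ (map₂ (from (P⇔Q _)))) (many K))

x∧y≡false⇔ : ∀ {x y} → (x ∧ y ≡ false) ⇔ (x ≡ true → y ≡ true → ⊥)
x∧y≡false⇔ {x} {y} = mk⇔ (forth x y) (back x y)
  where
  forth : ∀ x y → x ∧ y ≡ false → x ≡ true → y ≡ true → ⊥
  forth true true () _ _
  back : ∀ x y → (x ≡ true → y ≡ true → ⊥) → x ∧ y ≡ false
  back false _     _    = refl
  back true  false _    = refl
  back true  true  ¬x∧y = ⊥-elim (¬x∧y refl refl)

x∧¬y≡true⇔ : ∀ {x y} → (x ∧ not y ≡ true) ⇔ (x ≡ true × y ≡ false)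
x∧¬y≡true⇔ {x} {y} = mk⇔ (forth x y) λ { (refl , refl) → refl }
  where
  forth : ∀ x y → x ∧ not y ≡ true → x ≡ true × y ≡ false
  forth true false _ = refl , refl

x∧¬y≡false⇔ : ∀ {x y} → (x ∧ not y ≡ false) ⇔ (x ≡ true → y ≡ true)
x∧¬y≡false⇔ {x} {y} = mk⇔ (forth x y) (back x y)
  where
  forth : ∀ x y → x ∧ not y ≡ false → x ≡ true → y ≡ true
  forth true true _ _ = refl
  back : ∀ x y → (x ≡ true → y ≡ true) → x ∧ not y ≡ false
  back false _     _   = refl
  back true  true  _   = refl
  back true  false x⇒y = case x⇒y refl of λ ()

∧-does≡true⇔ : ∀ {b} {A : Set} (d : Dec A) → (b ∧ does d ≡ true) ⇔ (b ≡ true × A)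
∧-does≡true⇔ {true}  (yes a) = mk⇔ (λ _ → refl , a) (λ _ → refl)
∧-does≡true⇔ {true}  (no ¬a) = mk⇔ (λ ()) (λ (_ , a) → ⊥-elim (¬a a))
∧-does≡true⇔ {false} d       = mk⇔ (λ ()) (λ ())

does≡true⇒ : ∀ {A : Set} (d : Dec A) → does d ≡ true → A
does≡true⇒ (yes a) _ = a

module _ {d : ℕ} .{{_ : NonZero d}} where

  [1+m%n]%n≡[1+m]%n : ∀ a → suc (a % d) % d ≡ suc a % d
  [1+m%n]%n≡[1+m]%n a = begin
    (1 + a % d) % d          ≡⟨ %-distribˡ-+ 1 (a % d) d ⟩
    (1 % d + a % d % d) % d  ≡⟨ cong (λ r → (1 % d + r) % d) (m%n%n≡m%n a d) ⟩
    (1 % d + a % d) % d      ≡⟨ %-distribˡ-+ 1 a d ⟨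
    (1 + a) % d              ∎
    where open ≡-Reasoning

  %≡%⇔∣∸ : ∀ {a b} → b ≤ a → (a % d ≡ b % d) ⇔ (d ∣ℕ a ∸ b)
  %≡%⇔∣∸ {a} {b} b≤a = mk⇔ forth back
    where
    open ≡-Reasoning
    forth : a % d ≡ b % d → d ∣ℕ a ∸ b
    forth a%d≡b%d = divides (a / d ∸ b / d) (begin
      a ∸ b                                      ≡⟨ cong₂ _∸_ (m≡m%n+[m/n]*n a d) (m≡m%n+[m/n]*n b d) ⟩
      (a % d + a / d * d) ∸ (b % d + b / d * d)  ≡⟨ cong (λ r → r + a / d * d ∸ (b % d + b / d * d)) a%d≡b%d ⟩
      (b % d + a / d * d) ∸ (b % d + b / d * d)  ≡⟨ [m+n]∸[m+o]≡n∸o (b % d) _ _ ⟩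
      a / d * d ∸ b / d * d                      ≡⟨ *-distribʳ-∸ d (a / d) (b / d) ⟨
      (a / d ∸ b / d) * d                        ∎)
    back : d ∣ℕ a ∸ b → a % d ≡ b % d
    back d∣a∸b = begin
      a % d              ≡⟨ cong (_% d) (m+[n∸m]≡n b≤a) ⟨
      (b + (a ∸ b)) % d  ≡⟨ %-remove-+ʳ b d∣a∸b ⟩
      b % d              ∎

  ≡[mod]⇔%≡% : ∀ a b → (a ≡ b [mod d ]) ⇔ (a % d ≡ b % d)
  ≡[mod]⇔%≡% a b with ≤-total b a
  ... | inj₁ b≤a = mk⇔ (back ∘ subst (d ∣ℕ_) ∣a-b∣≡a∸b)
                       (subst (d ∣ℕ_) (sym ∣a-b∣≡a∸b) ∘ forth)
    where
    open Equivalence (%≡%⇔∣∸ b≤a) renaming (to to forth; from to back)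
    ∣a-b∣≡a∸b : ∣ ℤ.+ a ℤ.- ℤ.+ b ∣ ≡ a ∸ b
    ∣a-b∣≡a∸b = cong ∣_∣ (trans (m-n≡m⊖n a b) (⊖-≥ b≤a))
  ... | inj₂ a≤b = mk⇔ (sym ∘ back ∘ subst (d ∣ℕ_) ∣a-b∣≡b∸a)
                       (subst (d ∣ℕ_) (sym ∣a-b∣≡b∸a) ∘ forth ∘ sym)
    where
    open Equivalence (%≡%⇔∣∸ a≤b) renaming (to to forth; from to back)
    ∣a-b∣≡b∸a : ∣ ℤ.+ a ℤ.- ℤ.+ b ∣ ≡ b ∸ a
    ∣a-b∣≡b∸a = trans (cong ∣_∣ (m-n≡m⊖n a b)) (∣⊖∣-≤ a≤b)

  [m+n]%d≡m%d⇒n≡0 : ∀ a t → (a + t) % d ≡ a % d → t < d → t ≡ 0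
  [m+n]%d≡m%d⇒n≡0 a zero    _        _   = refl
  [m+n]%d≡m%d⇒n≡0 a (suc t) returns t<d =
    contradiction (subst (d ∣ℕ_) (m+n∸m≡n a (suc t)) (to (%≡%⇔∣∸ (m≤m+n a (suc t))) returns))
                  (>⇒∤ t<d)

  toℕ-mod : ∀ a → toℕ (a mod d) ≡ a % d
  toℕ-mod a = toℕ-fromℕ< (m%n<n a d)

  mod≡mod⇔%≡% : ∀ a b → (a mod d ≡ b mod d) ⇔ (a % d ≡ b % d)
  mod≡mod⇔%≡% a b = mk⇔
    (λ eq → trans (sym (toℕ-mod a)) (trans (cong toℕ eq) (toℕ-mod b)))
    (λ eq → toℕ-injective (trans (toℕ-mod a) (trans eq (sym (toℕ-mod b)))))

  mod≡mod⇔≡[mod] : ∀ a b → (a mod d ≡ b mod d) ⇔ (a ≡ b [mod d ])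
  mod≡mod⇔≡[mod] a b = ⇔-trans (mod≡mod⇔%≡% a b) (⇔-sym (≡[mod]⇔%≡% a b))

  next : Fin d → Fin d
  next c = suc (toℕ c) mod d

  next-mod : ∀ a → next (a mod d) ≡ suc a mod d
  next-mod a = from (mod≡mod⇔%≡% _ _) (trans (cong (λ r → suc r % d) (toℕ-mod a)) ([1+m%n]%n≡[1+m]%n a))

anyBelow : (ℕ → Bool) → ℕ → Bool
anyBelow g zero    = false
anyBelow g (suc l) = anyBelow g l ∨ g l

module _ (g : ℕ → Bool) where

  anyBelow-intro : ∀ {p l} → p < l → g p ≡ true → anyBelow g l ≡ true
  anyBelow-intro {p} {suc l} p<1+l gp with m≤n⇒m<n∨m≡n (s≤s⁻¹ p<1+l)
  ... | inj₁ p<l  rewrite anyBelow-intro p<l gp = refl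
  ... | inj₂ refl rewrite gp = ∨-zeroʳ (anyBelow g p)

  anyBelow-least : ∀ l → anyBelow g l ≡ true → Σ ℕ λ q → q < l × g q ≡ true × anyBelow g q ≡ false
  anyBelow-least (suc l) any with anyBelow g l in any<l
  ... | true  = let q , q<l , gq , first = anyBelow-least l any<l in q , m<n⇒m<1+n q<l , gq , first
  ... | false = l , n<1+n l , any , any<l

  anyBelow-first-unique : ∀ {p q} → g p ≡ true → anyBelow g p ≡ false →
                          g q ≡ true → anyBelow g q ≡ false → p ≡ q
  anyBelow-first-unique {p} {q} gp first-p gq first-q with <-cmp p q
  ... | tri< p<q _ _ = contradiction (trans (sym (anyBelow-intro p<q gp)) first-q) λ ()
  ... | tri≈ _ p≡q _ = p≡q
  ... | tri> _ _ q<p = contradiction (trans (sym (anyBelow-intro q<p gq)) first-p) λ ()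

x₀ : ∀ {k} → Term (suc k)
x₀ = var zero

x₁ : ∀ {k} → Term (suc (suc k))
x₁ = var (suc zero)

x₂ : ∀ {k} → Term (suc (suc (suc k)))
x₂ = var (suc (suc zero))

infix 4 _⊑_
_⊑_ : ∀ {k} → Term k → Term k → Formula k
s ⊑ t = (s ⊓ (∁ t)) ≐ 𝟘

Invariant : ∀ {k} → Term k → Formula k
Invariant t = (f t) ≐ t

⋀ : ∀ {m k} → (Fin m → Formula k) → Formula k
⋀ {zero}  φ = ⊤f
⋀ {suc m} φ = φ zero ∧f ⋀ (φ ∘ suc)

∃ⁿ : ∀ m {k} → Formula (m + k) → Formula k
∃ⁿ zero    φ = φ
∃ⁿ (suc m) φ = ∃ⁿ m (∃f φ)

extendⁿ : ∀ {m k} → (Fin m → Subset) → Env k → Env (m + k)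
extendⁿ {zero}  A ρ = ρ
extendⁿ {suc m} A ρ = extend (A zero) (extendⁿ (A ∘ suc) ρ)

-- With E = x₀ and Y = x₁ these read  ∀ X ⊑ E. ∃ Z. f Z = Z ∧ X = E ⊓ Z  and
-- ∀ Z. f Z = Z → Z ⊑ Y → Z ⊓ E = 0 → Z = 0.
AtMostOnePerBlock : ∀ {k} → Formula (suc k)
AtMostOnePerBlock = ∀f ((x₀ ⊑ x₁) ⇒f ∃f ((Invariant x₀) ∧f (x₁ ≐ (x₂ ⊓ x₀))))

MeetsEveryBlockOf : ∀ {k} → Formula (suc (suc k))
MeetsEveryBlockOf = ∀f ((Invariant x₀) ⇒f ((x₀ ⊑ x₂) ⇒f (((x₀ ⊓ x₁) ≐ 𝟘) ⇒f (x₀ ≐ 𝟘))))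

module _ {m : ℕ} .{{_ : NonZero m}} (target : Fin m) where

  colour : ∀ {k} → Fin m → Term (m + k)
  colour c = var (c ↑ˡ _)

  marker : ∀ {k} → Term (m + suc k)
  marker = var (m ↑ʳ zero)

  StepRule EntryRule : ∀ {k} → Fin m → Formula (m + suc k)
  StepRule c  = ((f (colour c)) ⊓ (∁ marker)) ⊑ colour (next c)
  EntryRule c = if does (next c ≟ᶠ target) then ⊤f else (((f (colour c)) ⊓ marker) ≐ 𝟘)

  Colouring : ∀ {k} → Formula (m + suc k)
  Colouring = (marker ⊑ colour (0 mod m)) ∧f ((⋀ StepRule) ∧f (⋀ EntryRule))

  Φ : ∀ {k} → Formula (suc k)
  Φ = (Invariant x₀) ∧f ∃f (AtMostOnePerBlock ∧f (MeetsEveryBlockOf ∧f ∃ⁿ m Colouring))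

  φ ψ : Sentence
  φ = ∃f ((x₀ ≐ 𝟙) ∧f Φ)
  ψ = ∃f ((¬f (x₀ ≐ 𝟘)) ∧f Φ)

module _ {P : Subset → Set} where

  ¬∀¬⇒¬¬∃ : ¬ (∀ a → ¬ P a) → ¬ ¬ Σ Subset P
  ¬∀¬⇒¬¬∃ = _∘ ¬∃⟶∀¬

  ¬¬∃⇒¬∀¬ : ¬ ¬ Σ Subset P → ¬ (∀ a → ¬ P a)
  ¬¬∃⇒¬∀¬ = _∘ ∀¬⟶¬∃

module _ (n : ℕ → ℕ) where

  Sat-∃ⁿ-elim : ∀ m {k} {ρ : Env k} {φ} →
                Sat n ρ (∃ⁿ m φ) → ¬ ¬ Σ (Fin m → Subset) λ A → Sat n (extendⁿ A ρ) φ
  Sat-∃ⁿ-elim zero    sat = pure ((λ ()) , sat)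
  Sat-∃ⁿ-elim (suc m) sat = do
    (A , sat′) ← Sat-∃ⁿ-elim m sat
    (a , sat″) ← ¬∀¬⇒¬¬∃ sat′
    pure (a ∷ A , sat″)

  Sat-∃ⁿ-intro : ∀ m {k} {ρ : Env k} {φ} A → Sat n (extendⁿ A ρ) φ → Sat n ρ (∃ⁿ m φ)
  Sat-∃ⁿ-intro zero    A sat = sat
  Sat-∃ⁿ-intro (suc m) A sat = Sat-∃ⁿ-intro m (A ∘ suc) λ ¬sat → ¬sat (A zero) sat

  Sat-⋀ : ∀ {m k} {ρ : Env k} (φ : Fin m → Formula k) → Sat n ρ (⋀ φ) ⇔ (∀ i → Sat n ρ (φ i))
  Sat-⋀ {zero}  φ = mk⇔ (λ _ ()) _
  Sat-⋀ {suc m} φ = mk⇔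
    (λ (sat , sats) → λ { zero → sat ; (suc i) → to (Sat-⋀ (φ ∘ suc)) sats i })
    (λ sats → sats zero , from (Sat-⋀ (φ ∘ suc)) (sats ∘ suc))

  Sat-⊑ : ∀ {k} (ρ : Env k) s t →
          Sat n ρ (s ⊑ t) ⇔ (¬ ¬ Eventually λ x → evalT n ρ s x ≡ true → evalT n ρ t x ≡ true)
  Sat-⊑ ρ s t = mk⇔ (¬¬-map (eventually-map (to x∧¬y≡false⇔)))
                    (¬¬-map (eventually-map (from x∧¬y≡false⇔)))

extendⁿ-↑ˡ : ∀ {m k} (A : Fin m → Subset) (ρ : Env k) c → extendⁿ A ρ (c ↑ˡ k) ≡ A c
extendⁿ-↑ˡ A ρ zero    = refl
extendⁿ-↑ˡ A ρ (suc c) = extendⁿ-↑ˡ (A ∘ suc) ρ c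

extendⁿ-↑ʳ : ∀ {m k} (A : Fin m → Subset) (ρ : Env k) v → extendⁿ A ρ (m ↑ʳ v) ≡ ρ v
extendⁿ-↑ʳ {zero}  A ρ v = refl
extendⁿ-↑ʳ {suc m} A ρ v = extendⁿ-↑ʳ (A ∘ suc) ρ v

module _ (n : ℕ → ℕ) {m : ℕ} .{{_ : NonZero m}} (target : Fin m) where

  record Coloured (E : Subset) (A : Fin m → Subset) (x : ℕ) : Set where
    field
      marked⇒A₀ : E x ≡ true → A (0 mod m) x ≡ true
      step      : ∀ c → A c (rotInv n x) ≡ true → E x ≡ false → A (next c) x ≡ true
      entry     : ∀ c → A c (rotInv n x) ≡ true → E x ≡ true → next c ≡ target

  Coloured-cong : ∀ {E E′ A A′ x} → E ≡ E′ → (∀ c → A c ≡ A′ c) →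
                  Coloured E A x → Coloured E′ A′ x
  Coloured-cong {A = A} {A′} {x} refl A≡A′ col = record
    { marked⇒A₀ = λ e → transport (0 mod m) x (marked⇒A₀ e)
    ; step      = λ c a e → transport (next c) x (step c (transport⁻¹ c (rotInv n x) a) e)
    ; entry     = λ c a e → entry c (transport⁻¹ c (rotInv n x) a) e
    }
    where
    open Coloured col
    transport : ∀ c y → A c y ≡ true → A′ c y ≡ true
    transport c y = subst (λ B → B y ≡ true) (A≡A′ c)
    transport⁻¹ : ∀ c y → A′ c y ≡ true → A c y ≡ true
    transport⁻¹ c y = subst (λ B → B y ≡ true) (sym (A≡A′ c))

  module _ {k} {ρ : Env k} {E : Subset} {A : Fin m → Subset} where

    private
      ρ′ : Env (m + suc k)
      ρ′ = extendⁿ A (extend E ρ)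

      E′ : Subset
      E′ = evalT n ρ′ (marker target)

      A′ : Fin m → Subset
      A′ c = evalT n ρ′ (colour target c)

      E′≡E : E′ ≡ E
      E′≡E = extendⁿ-↑ʳ A (extend E ρ) zero

      A′≡A : ∀ c → A′ c ≡ A c
      A′≡A = extendⁿ-↑ˡ A (extend E ρ)

      start⇔ : Sat n ρ′ (marker target ⊑ colour target (0 mod m)) ⇔
               (¬ ¬ Eventually λ x → E′ x ≡ true → A′ (0 mod m) x ≡ true)
      start⇔ = Sat-⊑ n ρ′ (marker target) (colour target (0 mod m))

      step⇔ : ∀ c → Sat n ρ′ (StepRule target c) ⇔
                    (¬ ¬ Eventually λ x → A′ c (rotInv n x) ∧ not (E′ x) ≡ true → A′ (next c) x ≡ true)
      step⇔ c = Sat-⊑ n ρ′ ((f (colour target c)) ⊓ (∁ marker target)) (colour target (next c))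

      Entries : Fin m → ℕ → Set
      Entries c x = A′ c (rotInv n x) ≡ true → E′ x ≡ true → next c ≡ target

      entry-sound : ∀ c → Sat n ρ′ (EntryRule target c) → ¬ ¬ Eventually (Entries c)
      entry-sound c sat with next c ≟ᶠ target
      ... | yes next≡target = pure (always λ _ _ _ → next≡target)
      ... | no  _           = ¬¬-map (eventually-map λ never a e → ⊥-elim (to x∧y≡false⇔ never a e)) sat

      entry-complete : ∀ c → Eventually (Entries c) → Sat n ρ′ (EntryRule target c)
      entry-complete c entries with next c ≟ᶠ target
      ... | yes _           = _
      ... | no  next≢target =
        pure (eventually-map (λ entry → from x∧y≡false⇔ λ a e → next≢target (entry a e)) entries)

    colouring-sound : Sat n ρ′ (Colouring target) → ¬ ¬ Eventually (Coloured E A)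
    colouring-sound (start , steps , entries) = do
      start   ← to start⇔ start
      steps   ← sequence ¬¬-applicative λ c → to (step⇔ c) (to (Sat-⋀ n (StepRule target)) steps c)
      entries ← sequence ¬¬-applicative λ c → entry-sound c (to (Sat-⋀ n (EntryRule target)) entries c)
      pure (eventually-map (Coloured-cong E′≡E A′≡A ∘ assemble)
             (eventually-zip start (eventually-zip (eventually-∀ steps) (eventually-∀ entries))))
      where
      assemble : ∀ {x} → (E′ x ≡ true → A′ (0 mod m) x ≡ true)
                        × (∀ c → A′ c (rotInv n x) ∧ not (E′ x) ≡ true → A′ (next c) x ≡ true)
                        × (∀ c → Entries c x) →
                 Coloured E′ A′ x
      assemble (start , steps , entries) = record
        { marked⇒A₀ = start
        ; step      = λ c a e → steps c (from x∧¬y≡true⇔ (a , e))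
        ; entry     = entries
        }

    colouring-complete : Eventually (Coloured E A) → Sat n ρ′ (Colouring target)
    colouring-complete coloured =
        from start⇔ (pure (eventually-map Coloured.marked⇒A₀ coloured′))
      , from (Sat-⋀ n (StepRule target)) (λ c → from (step⇔ c) (pure (eventually-map (step c) coloured′)))
      , from (Sat-⋀ n (EntryRule target))
             (λ c → entry-complete c (eventually-map (λ col → Coloured.entry col c) coloured′))
      where
      coloured′ : Eventually (Coloured E′ A′)
      coloured′ = eventually-map (Coloured-cong (sym E′≡E) (sym ∘ A′≡A)) coloured
      step : ∀ c {x} → Coloured E′ A′ x → A′ c (rotInv n x) ∧ not (E′ x) ≡ true → A′ (next c) x ≡ true
      step c col a∧¬e = let a , e = to x∧¬y≡true⇔ a∧¬e in Coloured.step col c a e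

module Blocks (n : ℕ → ℕ) (n>0 : ∀ k → 0 < n k) where

  instance
    n-nonZero : ∀ {k} → NonZero (n k)
    n-nonZero {k} = >-nonZero (n>0 k)

  n∸1<n : ∀ k → n k ∸ 1 < n k
  n∸1<n k = ∸-monoʳ-< z<s (n>0 k)

  S<S[1+k] : ∀ k → S n k < S n (suc k)
  S<S[1+k] k = m<m+n (S n k) (n>0 k)

  S-mono-≤ : ∀ {k k′} → k ≤ k′ → S n k ≤ S n k′
  S-mono-≤ {k′ = zero}   z≤n = ≤-refl
  S-mono-≤ {k′ = suc k′} k≤1+k′ with m≤n⇒m<n∨m≡n k≤1+k′
  ... | inj₁ k<1+k′ = ≤-trans (S-mono-≤ (s≤s⁻¹ k<1+k′)) (<⇒≤ (S<S[1+k] k′))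
  ... | inj₂ refl   = ≤-refl

  k≤S : ∀ k → k ≤ S n k
  k≤S zero    = z≤n
  k≤S (suc k) = ≤-trans (s≤s (k≤S k)) (S<S[1+k] k)

  block-unique : ∀ {k k′ x} → S n k ≤ x → x < S n (suc k) →
                 S n k′ ≤ x → x < S n (suc k′) → k ≡ k′
  block-unique {k} {k′} S≤x x<S S′≤x x<S′ with <-cmp k k′
  ... | tri< k<k′ _ _ = contradiction (≤-trans (S-mono-≤ k<k′) S′≤x) (<⇒≱ x<S)
  ... | tri≈ _ k≡k′ _ = k≡k′
  ... | tri> _ _ k′<k = contradiction (≤-trans (S-mono-≤ k′<k) S≤x) (<⇒≱ x<S′)

  blockFrom-spec : ∀ fuel k x → S n k ≤ x → x < S n (k + fuel) →
                   S n (blockFrom n fuel k x) ≤ x × x < S n (suc (blockFrom n fuel k x))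
  blockFrom-spec zero       k x S≤x x<S =
    contradiction (subst (λ i → x < S n i) (+-identityʳ k) x<S) (≤⇒≯ S≤x)
  blockFrom-spec (suc fuel) k x S≤x x<S with x <ᵇ S n (suc k) in found
  ... | true  = S≤x , <ᵇ⇒< x _ (subst T (sym found) _)
  ... | false = blockFrom-spec fuel (suc k) x (≮⇒≥ λ x<S′ → subst T found (<⇒<ᵇ x<S′))
                                              (subst (λ i → x < S n i) (+-suc k fuel) x<S)

  block-spec : ∀ x → S n (block n x) ≤ x × x < S n (suc (block n x))
  block-spec x = blockFrom-spec (suc x) 0 x z≤n (k≤S (suc x))

  block-of : ∀ {k x} → S n k ≤ x → x < S n (suc k) → block n x ≡ k
  block-of = block-unique (proj₁ (block-spec _)) (proj₂ (block-spec _))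

  block-pt : ∀ {k p} → p < n k → block n (S n k + p) ≡ k
  block-pt {k} p<n = block-of (m≤m+n (S n k) _) (+-monoʳ-< (S n k) p<n)

  block-S : ∀ k → block n (S n k) ≡ k
  block-S k = block-of ≤-refl (S<S[1+k] k)

  S≤x⇒k≤block : ∀ {k x} → S n k ≤ x → k ≤ block n x
  S≤x⇒k≤block S≤x = ≮⇒≥ λ b<k → <⇒≱ (proj₂ (block-spec _)) (≤-trans (S-mono-≤ b<k) S≤x)

  offset : ℕ → ℕ
  offset x = x ∸ S n (block n x)

  S+offset : ∀ x → S n (block n x) + offset x ≡ x
  S+offset x = m+[n∸m]≡n (proj₁ (block-spec x))

  offset< : ∀ x → offset x < n (block n x)
  offset< x = +-cancelˡ-< (S n (block n x)) _ _
                (subst (_< S n (suc (block n x))) (sym (S+offset x)) (proj₂ (block-spec x)))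

  offset-pt : ∀ {k p} → p < n k → offset (S n k + p) ≡ p
  offset-pt {k} {p} p<n = trans (cong (λ b → S n k + p ∸ S n b) (block-pt p<n)) (m+n∸m≡n (S n k) p)

  rotInv-zero : ∀ k → rotInv n (S n k + 0) ≡ S n k + (n k ∸ 1)
  rotInv-zero k rewrite block-pt {k} (n>0 k) | +-identityʳ (S n k) with S n k ≡ᵇ S n k in at-start
  ... | true  = +-∸-assoc (S n k) (n>0 k)
  ... | false = contradiction (≡⇒≡ᵇ (S n k) (S n k) refl) (subst T at-start)

  rotInv-suc : ∀ {k p} → suc p < n k → rotInv n (S n k + suc p) ≡ S n k + p
  rotInv-suc {k} {p} 1+p<n rewrite block-pt 1+p<n with S n k + suc p ≡ᵇ S n k in at-start
  ... | true  = contradiction (≡ᵇ⇒≡ _ _ (subst T (sym at-start) _)) (m+1+n≢m (S n k))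
  ... | false = cong (_∸ 1) (+-suc (S n k) p)

  rotInv-pt : ∀ {k p} → p < n k → rotInv n (S n k + suc p % n k) ≡ S n k + p
  rotInv-pt {k} {p} p<n with m≤n⇒m<n∨m≡n p<n
  ... | inj₁ 1+p<n rewrite m<n⇒m%n≡m 1+p<n = rotInv-suc 1+p<n
  ... | inj₂ 1+p≡n = begin
    rotInv n (S n k + suc p % n k)  ≡⟨ cong (λ i → rotInv n (S n k + i % n k)) 1+p≡n ⟩
    rotInv n (S n k + n k % n k)    ≡⟨ cong (λ i → rotInv n (S n k + i)) (n%n≡0 (n k)) ⟩
    rotInv n (S n k + 0)            ≡⟨ rotInv-zero k ⟩
    S n k + (n k ∸ 1)               ≡⟨ cong (λ i → S n k + (i ∸ 1)) 1+p≡n ⟨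
    S n k + p                       ∎
    where open ≡-Reasoning

  block-rotInv-pt : ∀ k p → p < n k → block n (rotInv n (S n k + p)) ≡ k
  block-rotInv-pt k zero    _     = trans (cong (block n) (rotInv-zero k)) (block-pt (n∸1<n k))
  block-rotInv-pt k (suc p) 1+p<n = trans (cong (block n) (rotInv-suc 1+p<n)) (block-pt (<-trans (n<1+n p) 1+p<n))

  block-rotInv : ∀ x → block n (rotInv n x) ≡ block n x
  block-rotInv x = subst (λ y → block n (rotInv n y) ≡ block n y) (S+offset x)
    (trans (block-rotInv-pt (block n x) (offset x) (offset< x)) (sym (block-pt (offset< x))))

  OnBlock : (ℕ → Set) → ℕ → Set
  OnBlock P k = ∀ p → p < n k → P (S n k + p)

  BlockConstant : Subset → ℕ → Set
  BlockConstant Z k = OnBlock (λ x → Z x ≡ Z (S n k)) k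

  blocksWhere : (ℕ → Bool) → Subset
  blocksWhere P x = P (block n x)

  atPositions : (ℕ → ℕ → Bool) → Subset
  atPositions Q x = Q (block n x) (offset x)

  atPositions-pt : ∀ Q {k p} → p < n k → atPositions Q (S n k + p) ≡ Q k p
  atPositions-pt Q p<n = cong₂ Q (block-pt p<n) (offset-pt p<n)

  module _ {P : ℕ → Set} where

    eventually-onBlock : Eventually P → Eventually (OnBlock P)
    eventually-onBlock (N , h) = N , λ k N≤k p _ → h _ (≤-trans N≤k (≤-trans (k≤S k) (m≤m+n (S n k) p)))

    eventually-fromBlocks : Eventually (OnBlock P) → Eventually P
    eventually-fromBlocks (N , h) = S n N , λ x SN≤x →
      subst P (S+offset x) (h (block n x) (S≤x⇒k≤block SN≤x) (offset x) (offset< x))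

    eventually-starts : Eventually P → Eventually (λ k → P (S n k))
    eventually-starts (N , h) = N , λ k N≤k → h (S n k) (≤-trans N≤k (k≤S k))

  α-blocksWhere : ∀ P x → α n (blocksWhere P) x ≡ blocksWhere P x
  α-blocksWhere P x = cong P (block-rotInv x)

  invariant⇒blockConstant : ∀ {Z} → α n Z =* Z → Eventually (BlockConstant Z)
  invariant⇒blockConstant {Z} invariant = eventually-map constant (eventually-onBlock invariant)
    where
    constant : ∀ {k} → OnBlock (λ x → α n Z x ≡ Z x) k → BlockConstant Z k
    constant {k} _     zero    _     = cong Z (+-identityʳ (S n k))
    constant {k} α-fix (suc p) 1+p<n = begin
      Z (S n k + suc p)             ≡⟨ α-fix (suc p) 1+p<n ⟨
      Z (rotInv n (S n k + suc p))  ≡⟨ cong Z (rotInv-suc 1+p<n) ⟩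
      Z (S n k + p)                 ≡⟨ constant α-fix p (<-trans (n<1+n p) 1+p<n) ⟩
      Z (S n k)                     ∎
      where open ≡-Reasoning

  blockConstant-pointwise : ∀ {Z} → Eventually (BlockConstant Z) →
                            Eventually (λ x → Z x ≡ Z (S n (block n x)))
  blockConstant-pointwise {Z} = eventually-fromBlocks ∘ eventually-map λ Z-const p p<n →
    trans (Z-const p p<n) (cong (Z ∘ S n) (sym (block-pt p<n)))

  module Walk (k : ℕ) {q : ℕ} (q<n : q < n k) where

    walk : ℕ → ℕ
    walk t = S n k + (q + t) % n k

    rotInv-walk : ∀ t → rotInv n (walk (suc t)) ≡ walk t
    rotInv-walk t = begin
      rotInv n (S n k + (q + suc t) % n k)          ≡⟨ cong (λ i → rotInv n (S n k + i % n k)) (+-suc q t) ⟩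
      rotInv n (S n k + suc (q + t) % n k)          ≡⟨ cong (λ i → rotInv n (S n k + i))
                                                            ([1+m%n]%n≡[1+m]%n {d = n k} (q + t)) ⟨
      rotInv n (S n k + suc ((q + t) % n k) % n k)  ≡⟨ rotInv-pt (m%n<n (q + t) (n k)) ⟩
      walk t                                        ∎
      where open ≡-Reasoning

    walk-0 : walk 0 ≡ S n k + q
    walk-0 = cong (S n k +_) (trans (cong (_% n k) (+-identityʳ q)) (m<n⇒m%n≡m q<n))

    walk-n : walk (n k) ≡ S n k + q
    walk-n = cong (S n k +_) (trans ([m+n]%n≡m%n q (n k)) (m<n⇒m%n≡m q<n))

    walk-returns : ∀ t → t < n k → (q + t) % n k ≡ q → t ≡ 0
    walk-returns t t<n returns = [m+n]%d≡m%d⇒n≡0 q t (trans returns (sym (m<n⇒m%n≡m q<n))) t<n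

  winding : ∀ {m} .{{_ : NonZero m}} (target : Fin m) {E A k q} → q < n k → E (S n k + q) ≡ true →
            (∀ {p} → p < n k → E (S n k + p) ≡ true → p ≡ q) →
            OnBlock (Coloured n target E A) k → n k mod m ≡ target
  winding {m} target {E} {A} {k} {q} q<n marked unique coloured = begin
    n k mod m               ≡⟨ cong (_mod m) (suc-pred (n k)) ⟨
    suc (n k ∸ 1) mod m     ≡⟨ next-mod (n k ∸ 1) ⟨
    next ((n k ∸ 1) mod m)  ≡⟨ Coloured.entry (colouring (n k)) _ entered marked-end ⟩
    target                  ∎
    where
    open ≡-Reasoning
    open Walk k q<n

    colouring : ∀ t → Coloured n target E A (walk t)
    colouring t = coloured _ (m%n<n (q + t) (n k))

    unmarked : ∀ t → suc t < n k → E (walk (suc t)) ≡ false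
    unmarked t 1+t<n = ¬-not λ marked-t →
      contradiction (walk-returns (suc t) 1+t<n (unique (m%n<n (q + suc t) (n k)) marked-t)) λ ()

    coloured-walk : ∀ t → t < n k → A (t mod m) (walk t) ≡ true
    coloured-walk zero    _     =
      Coloured.marked⇒A₀ (colouring 0) (subst (λ x → E x ≡ true) (sym walk-0) marked)
    coloured-walk (suc t) 1+t<n = subst (λ c → A c (walk (suc t)) ≡ true) (next-mod t)
      (Coloured.step (colouring (suc t)) (t mod m)
        (subst (λ x → A (t mod m) x ≡ true) (sym (rotInv-walk t)) (coloured-walk t (<-trans (n<1+n t) 1+t<n)))
        (unmarked t 1+t<n))

    marked-end : E (walk (n k)) ≡ true
    marked-end = subst (λ x → E x ≡ true) (sym walk-n) marked

    entered : A ((n k ∸ 1) mod m) (rotInv n (walk (n k))) ≡ true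
    entered = subst (λ x → A _ x ≡ true)
      (sym (trans (cong (rotInv n ∘ walk) (sym (suc-pred (n k)))) (rotInv-walk (n k ∸ 1))))
      (coloured-walk (n k ∸ 1) (n∸1<n k))

module Semantics (n : ℕ → ℕ) (n>0 : ∀ k → 0 < n k) where

  open Blocks n n>0

  blockTrace : Subset → ℕ → ℕ → Bool
  blockTrace E k p = E (S n k + p)

  firstMarks : Subset → Subset
  firstMarks E x = E x ∧ not (anyBelow (blockTrace E (block n x)) (offset x))

  firstMarks-pt : ∀ E {k p} → p < n k →
                  firstMarks E (S n k + p) ≡ E (S n k + p) ∧ not (anyBelow (blockTrace E k) p)
  firstMarks-pt E {k} {p} p<n =
    cong₂ (λ b o → E (S n k + p) ∧ not (anyBelow (blockTrace E b) o)) (block-pt p<n) (offset-pt p<n)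

  FirstMarksOnly : Subset → ℕ → Set
  FirstMarksOnly E k = ∀ p → p < n k → E (S n k + p) ≡ true → anyBelow (blockTrace E k) p ≡ false

  module _ {k} {ρ : Env k} where

    -- Let Z be invariant with firstMarks E = E ⊓ Z.  If a mark p of a block had an earlier mark, the
    -- least one would put the whole block into Z, so p would be a first mark after all.
    atMostOnePerBlock-sound : ∀ {E} → Sat n (extend E ρ) AtMostOnePerBlock → ¬ ¬ Eventually (FirstMarksOnly E)
    atMostOnePerBlock-sound {E} atMostOne = do
      (Z , Z-inv , first≈E⊓Z) ← ¬∀¬⇒¬¬∃ (atMostOne (firstMarks E) (pure (always firstMarks⊑E)))
      Z-inv     ← Z-inv
      first≈E⊓Z ← first≈E⊓Z
      pure (eventually-map (onlyFirst {Z}) (eventually-zip (invariant⇒blockConstant Z-inv)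
                                                           (eventually-onBlock first≈E⊓Z)))
      where
      firstMarks⊑E : ∀ x → firstMarks E x ∧ not (E x) ≡ false
      firstMarks⊑E x = from (x∧¬y≡false⇔ {firstMarks E x} {E x}) (∧-conicalˡ _ _)

      onlyFirst : ∀ {Z k} → BlockConstant Z k × OnBlock (λ x → firstMarks E x ≡ E x ∧ Z x) k →
                  FirstMarksOnly E k
      onlyFirst {Z} {k} (Z-const , first≈) p p<n marked with anyBelow (blockTrace E k) p in earlier
      ... | false = refl
      ... | true with anyBelow-least (blockTrace E k) p earlier
      ...   | r , r<p , marked-r , first-r = contradiction (trans (sym first) not-first) λ ()
        where
        open ≡-Reasoning
        r<n : r < n k
        r<n = <-trans r<p p<n
        Z-r : Z (S n k + r) ≡ true
        Z-r = ∧-conicalʳ _ _ (begin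
          E (S n k + r) ∧ Z (S n k + r)                      ≡⟨ first≈ r r<n ⟨
          firstMarks E (S n k + r)                           ≡⟨ firstMarks-pt E r<n ⟩
          E (S n k + r) ∧ not (anyBelow (blockTrace E k) r)  ≡⟨ cong₂ (λ a b → a ∧ not b) marked-r first-r ⟩
          true                                               ∎)
        first : firstMarks E (S n k + p) ≡ true
        first = begin
          firstMarks E (S n k + p)       ≡⟨ first≈ p p<n ⟩
          E (S n k + p) ∧ Z (S n k + p)  ≡⟨ cong (E (S n k + p) ∧_) (Z-const p p<n) ⟩
          E (S n k + p) ∧ Z (S n k)      ≡⟨ cong₂ _∧_ marked (trans (sym (Z-const r r<n)) Z-r) ⟩
          true                           ∎
        not-first : firstMarks E (S n k + p) ≡ false
        not-first = begin
          firstMarks E (S n k + p)                           ≡⟨ firstMarks-pt E p<n ⟩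
          E (S n k + p) ∧ not (anyBelow (blockTrace E k) p)  ≡⟨ cong (λ b → E (S n k + p) ∧ not b) earlier ⟩
          E (S n k + p) ∧ false                              ≡⟨ ∧-zeroʳ _ ⟩
          false                                              ∎

    atMostOnePerBlock-complete : ∀ {E} → (∀ x → E x ≡ true → offset x ≡ 0) →
                                 Sat n (extend E ρ) AtMostOnePerBlock
    atMostOnePerBlock-complete {E} atStart X X⊑E = ¬¬∃⇒¬∀¬ do
      (N , X⊑E) ← X⊑E
      pure ( blocksWhere (X ∘ S n)
           , pure (always (α-blocksWhere (X ∘ S n)))
           , pure (N , λ x N≤x → X≈E⊓Z x (X⊑E x N≤x)))
      where
      X≈E⊓Z : ∀ x → X x ∧ not (E x) ≡ false → X x ≡ E x ∧ X (S n (block n x))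
      X≈E⊓Z x X⊑E with E x in marked
      ... | true  = cong X (begin
        x                           ≡⟨ S+offset x ⟨
        S n (block n x) + offset x  ≡⟨ cong (S n (block n x) +_) (atStart x marked) ⟩
        S n (block n x) + 0         ≡⟨ +-identityʳ _ ⟩
        S n (block n x)             ∎)
        where open ≡-Reasoning
      ... | false = trans (sym (∧-identityʳ (X x))) X⊑E

    meetsEveryBlock-sound : ∀ {Y E} → Eventually (BlockConstant Y) →
                            Sat n (extend E (extend Y ρ)) MeetsEveryBlockOf →
                            ¬ ¬ Eventually λ k → Y (S n k) ≡ true → anyBelow (blockTrace E k) (n k) ≡ true
    meetsEveryBlock-sound {Y} {E} Y-const meets = do
      U≈∅ ← meets U (pure (always (α-blocksWhere unmarked)))
                     (pure (eventually-map U⊑Y (blockConstant-pointwise Y-const)))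
                     (pure (always U⊓E≡∅))
      pure (eventually-map marked (eventually-starts U≈∅))
      where
      unmarked : ℕ → Bool
      unmarked k = Y (S n k) ∧ not (anyBelow (blockTrace E k) (n k))

      U : Subset
      U = blocksWhere unmarked

      U⊑Y : ∀ {x} → Y x ≡ Y (S n (block n x)) → U x ∧ not (Y x) ≡ false
      U⊑Y {x} Y-const = from (x∧¬y≡false⇔ {U x} {Y x}) λ u → trans Y-const (∧-conicalˡ _ _ u)

      U⊓E≡∅ : ∀ x → U x ∧ E x ≡ false
      U⊓E≡∅ x = from (x∧y≡false⇔ {U x} {E x}) λ u e → contradiction
        (trans (sym (∧-conicalʳ _ _ u)) (cong not (anyBelow-intro _ (offset< x) (trans (cong E (S+offset x)) e))))
        λ ()

      marked : ∀ {k} → U (S n k) ≡ false → Y (S n k) ≡ true → anyBelow (blockTrace E k) (n k) ≡ true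
      marked {k} U≡false Y≡true = ¬-not λ none → contradiction (begin
        true        ≡⟨ cong₂ (λ y a → y ∧ not a) Y≡true none ⟨
        unmarked k  ≡⟨ cong unmarked (block-S k) ⟨
        U (S n k)   ≡⟨ U≡false ⟩
        false       ∎) λ ()
        where open ≡-Reasoning

    meetsEveryBlock-complete : ∀ {P E} → (∀ k → P k ≡ true → E (S n k) ≡ true) →
                               Sat n (extend E (extend (blocksWhere P) ρ)) MeetsEveryBlockOf
    meetsEveryBlock-complete {P} {E} starts Z Z-inv Z⊑Y Z⊓E≡∅ = do
      Z-inv ← Z-inv
      Z⊑Y   ← Z⊑Y
      Z⊓E≡∅ ← Z⊓E≡∅
      pure (eventually-fromBlocks (eventually-map (empty {Z})
        (eventually-zip (invariant⇒blockConstant Z-inv) (eventually-starts (eventually-zip Z⊑Y Z⊓E≡∅)))))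
      where
      empty : ∀ {Z k} → BlockConstant Z k × (Z (S n k) ∧ not (P (block n (S n k))) ≡ false)
                                          × (Z (S n k) ∧ E (S n k) ≡ false) →
              OnBlock (λ x → Z x ≡ false) k
      empty {Z} {k} (Z-const , Z⊑Y , Z⊓E) p p<n = trans (Z-const p p<n) (¬-not λ Z-start →
        to (x∧y≡false⇔ {Z (S n k)}) Z⊓E Z-start
           (starts k (subst (λ b → P b ≡ true) (block-S k) (to (x∧¬y≡false⇔ {Z (S n k)}) Z⊑Y Z-start))))

  module _ {m : ℕ} .{{_ : NonZero m}} (target : Fin m) where

    winding-firstMarks : ∀ {E A k} → anyBelow (blockTrace E k) (n k) ≡ true → FirstMarksOnly E k →
                         OnBlock (Coloured n target E A) k → n k mod m ≡ target
    winding-firstMarks {E} {A} {k} any onlyFirst coloured with anyBelow-least (blockTrace E k) (n k) any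
    ... | q , q<n , marked-q , first-q = winding target q<n marked-q
      (λ p<n marked-p → anyBelow-first-unique _ marked-p (onlyFirst _ p<n marked-p) marked-q first-q) coloured

    Φ-sound : ∀ {k} {ρ : Env k} {Y} → Sat n (extend Y ρ) (Φ target) →
              ¬ ¬ Eventually λ k → Y (S n k) ≡ true → n k mod m ≡ target
    Φ-sound {ρ = ρ} {Y} (Y-inv , ∃E) = do
      Y-inv                        ← Y-inv
      (E , atMostOne , meets , ∃A) ← ¬∀¬⇒¬¬∃ ∃E
      (A , colouring)              ← Sat-∃ⁿ-elim n m ∃A
      onlyFirst                    ← atMostOnePerBlock-sound {ρ = extend Y ρ} {E = E} atMostOne
      marked                       ← meetsEveryBlock-sound {ρ = ρ} {E = E} (invariant⇒blockConstant Y-inv) meets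
      coloured                     ← colouring-sound n target colouring
      pure (eventually-map (λ (marked , onlyFirst , coloured) Y-start →
                              winding-firstMarks (marked Y-start) onlyFirst coloured)
             (eventually-zip marked (eventually-zip onlyFirst (eventually-onBlock coloured))))

    startsOf : (ℕ → Bool) → Subset
    startsOf P = atPositions λ k p → P k ∧ does (p ≟ 0)

    offsetColours : (ℕ → Bool) → Fin m → Subset
    offsetColours P c = atPositions λ k p → P k ∧ does (p mod m ≟ᶠ c)

    module _ (P : ℕ → Bool) {k : ℕ} where

      startsOf-pt : ∀ {p} → p < n k → (startsOf P (S n k + p) ≡ true) ⇔ (P k ≡ true × p ≡ 0)
      startsOf-pt {p} p<n = subst (λ b → (b ≡ true) ⇔ (P k ≡ true × p ≡ 0))
        (sym (atPositions-pt (λ k p → P k ∧ does (p ≟ 0)) p<n)) (∧-does≡true⇔ (p ≟ 0))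

      offsetColours-pt : ∀ {p c} → p < n k →
                         (offsetColours P c (S n k + p) ≡ true) ⇔ (P k ≡ true × p mod m ≡ c)
      offsetColours-pt {p} {c} p<n = subst (λ b → (b ≡ true) ⇔ (P k ≡ true × p mod m ≡ c))
        (sym (atPositions-pt (λ k p → P k ∧ does (p mod m ≟ᶠ c)) p<n)) (∧-does≡true⇔ (p mod m ≟ᶠ c))

      private
        lastColour : ∀ {c} → offsetColours P c (rotInv n (S n k + 0)) ≡ true →
                     P k ≡ true × (n k ∸ 1) mod m ≡ c
        lastColour = to (offsetColours-pt (n∸1<n k)) ∘ subst (λ x → offsetColours P _ x ≡ true) (rotInv-zero k)

      offsetColouring : (P k ≡ true → n k mod m ≡ target) →
                        OnBlock (Coloured n target (startsOf P) (offsetColours P)) k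
      offsetColouring good zero 0<n = record
        { marked⇒A₀ = λ start → from (offsetColours-pt 0<n) (proj₁ (to (startsOf-pt 0<n) start) , refl)
        ; step      = λ c last notStart → case trans (sym notStart)
                        (from (startsOf-pt 0<n) (proj₁ (lastColour last) , refl)) of λ ()
        ; entry     = λ c last _ → let Pk , colour≡c = lastColour last in begin
            next c                  ≡⟨ cong next colour≡c ⟨
            next ((n k ∸ 1) mod m)  ≡⟨ next-mod (n k ∸ 1) ⟩
            suc (n k ∸ 1) mod m     ≡⟨ cong (_mod m) (suc-pred (n k)) ⟩
            n k mod m               ≡⟨ good Pk ⟩
            target                  ∎
        }
        where open ≡-Reasoning
      offsetColouring good (suc p) 1+p<n = record
        { marked⇒A₀ = λ start → case proj₂ (to (startsOf-pt 1+p<n) start) of λ ()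
        ; step      = λ c previous _ →
            let Pk , colour≡c = to (offsetColours-pt (<-trans (n<1+n p) 1+p<n))
                                   (subst (λ x → offsetColours P c x ≡ true) (rotInv-suc 1+p<n) previous)
            in from (offsetColours-pt 1+p<n) (Pk , trans (sym (next-mod p)) (cong next colour≡c))
        ; entry     = λ _ _ start → case proj₂ (to (startsOf-pt 1+p<n) start) of λ ()
        }

    Φ-complete : ∀ {k} {ρ : Env k} P → Eventually (λ k → P k ≡ true → n k mod m ≡ target) →
                 Sat n (extend (blocksWhere P) ρ) (Φ target)
    Φ-complete {ρ = ρ} P good =
        pure (always (α-blocksWhere P))
      , ¬¬∃⇒¬∀¬ (pure ( startsOf P
                      , atMostOnePerBlock-complete {ρ = extend (blocksWhere P) ρ} atStart
                      , meetsEveryBlock-complete {ρ = ρ} starts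
                      , Sat-∃ⁿ-intro n m (offsetColours P) (colouring-complete n target coloured)))
      where
      atStart : ∀ x → startsOf P x ≡ true → offset x ≡ 0
      atStart x = proj₂ ∘ to (∧-does≡true⇔ (offset x ≟ 0))
      starts : ∀ k → P k ≡ true → startsOf P (S n k) ≡ true
      starts k Pk =
        subst (λ x → startsOf P x ≡ true) (+-identityʳ (S n k)) (from (startsOf-pt P (n>0 k)) (Pk , refl))
      coloured : Eventually (Coloured n target (startsOf P) (offsetColours P))
      coloured = eventually-fromBlocks (eventually-map (offsetColouring P) good)

module Sentences (n : ℕ → ℕ) (n>0 : ∀ k → 0 < n k) {m : ℕ} .{{_ : NonZero m}} (target : Fin m) where

  open Blocks n n>0
  open Semantics n n>0

  Good : ℕ → Set
  Good k = n k mod m ≡ target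

  noGoodAfter⇒empty : ∀ {Y K} → ¬ (Σ ℕ λ k → K ≤ k × Good k) →
                      Eventually (λ k → (Y (S n k) ≡ true → Good k) × BlockConstant Y k) → Y =* (λ _ → false)
  noGoodAfter⇒empty {Y} {K} none =
    eventually-fromBlocks ∘ eventually-map empty ∘ eventually-zip (K , λ _ K≤k → K≤k)
    where
    empty : ∀ {k} → K ≤ k × (Y (S n k) ≡ true → Good k) × BlockConstant Y k →
            OnBlock (λ x → Y x ≡ false) k
    empty {k} (K≤k , good , Y-const) p p<n =
      trans (Y-const p p<n) (¬-not λ Y-start → none (k , K≤k , good Y-start))

  almostAll : (n ⊨ φ target) ⇔ AlmostAll Good
  almostAll = mk⇔ sound complete
    where
    sound : n ⊨ φ target → AlmostAll Good
    sound sat = do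
      (Y , Y≈𝟙 , satΦ) ← ¬∀¬⇒¬¬∃ sat
      Y≈𝟙              ← Y≈𝟙
      good             ← Φ-sound target satΦ
      pure (eventually-map (λ (Y-start , good) → good Y-start) (eventually-zip (eventually-starts Y≈𝟙) good))
    complete : AlmostAll Good → n ⊨ φ target
    complete almostAll = ¬¬∃⇒¬∀¬ do
      good ← almostAll
      pure ( blocksWhere (λ _ → true)
           , pure (always λ _ → refl)
           , Φ-complete target (λ _ → true) (eventually-map (λ good _ → good) good))

  infinitelyMany : (n ⊨ ψ target) ⇔ InfinitelyMany Good
  infinitelyMany = mk⇔ sound complete
    where
    sound : n ⊨ ψ target → InfinitelyMany Good
    sound sat K none = ¬∀¬⇒¬¬∃ sat λ (Y , nonEmpty , satΦ) → nonEmpty do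
      good  ← Φ-sound target satΦ
      Y-inv ← proj₁ satΦ
      pure (noGoodAfter⇒empty none (eventually-zip good (invariant⇒blockConstant Y-inv)))

    good? : ℕ → Bool
    good? k = does (n k mod m ≟ᶠ target)

    goodBlocksNonEmpty : InfinitelyMany Good → ¬ ¬ (blocksWhere good? =* (λ _ → false)) → ⊥
    goodBlocksNonEmpty many empty = empty λ (N , Y≈∅) → many N λ (k , N≤k , good) → case begin
      true                        ≡⟨ dec-true (_ ≟ᶠ _) good ⟨
      good? k                     ≡⟨ cong good? (block-S k) ⟨
      blocksWhere good? (S n k)   ≡⟨ Y≈∅ (S n k) (≤-trans N≤k (k≤S k)) ⟩
      false                       ∎ of λ ()
      where open ≡-Reasoning

    complete : InfinitelyMany Good → n ⊨ ψ target
    complete many = ¬¬∃⇒¬∀¬ (pure ( blocksWhere good?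
                                  , goodBlocksNonEmpty many
                                  , Φ-complete target good? (always λ k → does≡true⇒ (_ ≟ᶠ _))))

theorem5p5 : (m j : ℕ) → j < m →
    Σ Sentence λ φ → Σ Sentence λ ψ →
      ((n : ℕ → ℕ) → (∀ k → 0 < n k) →
          ((n ⊨ φ) ⇔ AlmostAll (λ k → n k ≡ j [mod m ]))
        × ((n ⊨ ψ) ⇔ InfinitelyMany (λ k → n k ≡ j [mod m ])))
theorem5p5 zero      j ()
theorem5p5 m@(suc _) j _ = φ (j mod m) , ψ (j mod m) , λ n n>0 →
  let open Sentences n n>0 (j mod m) in
    ⇔-trans almostAll      (AlmostAll-cong      λ k → mod≡mod⇔≡[mod] (n k) j)
  , ⇔-trans infinitelyMany (InfinitelyMany-cong λ k → mod≡mod⇔≡[mod] (n k) j)
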